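{- Consider $\mathbb{Z}_{12}$ with the symmetric generating set $S=\{3,4,8,9\}$ and let $K'=\{0\}\cup S=\{0,3,4,8,9\}$. There exist exactly four partitions $(K_i,D_i)_{i=1}^4$ of $\mathbb{Z}_{12}$ (i.e. $K_i\cap D_i=\emptyset$, $K_i\cup D_i=\mathbb{Z}_{12}$) such that $K'\subset K_i$ and there exists a unique affine transformation $T_i:\mathbb{Z}_{12}\to\mathbb{Z}_{12}$ satisfying $$T_i^2=\mathrm{Id},\qquad T_i(K_i)=D_i,\qquad T_i \text{ is an isometry of the unoriented Cayley graph of } \mathbb{Z}_{12} \text{ w.r.t. } S,$$ for each $i\in\{1,2,3,4\}$. These partitions are $K_1=\{0,3,4,7,8,9\}$, $D_1=\{1,2,5,6,10,11\}$ and $K_2=\{0,1,3,4,8,9\}$, $D_2=\{2,5,6,7,10,11\}$, both corresponding to the unique affine map $T(x)=5x\oplus 2$; and $K_3=\{0,3,4,5,8,9\}$, $D_3=\{1,2,6,7,10,11\}$ and $K_4=\{0,3,4,8,9,11\}$, $D_4=\{1,2,5,6,7,10\}$, both corresponding to the unique affine map $T(x)=5x\oplus 10$.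
   Context: $\mathbb{Z}_{12}=\{0,\dots,11\}$ with $a\oplus b=(a+b)\bmod 12$; $5x$ means $5x \bmod 12$. An affine transformation of $\mathbb{Z}_{12}$ is a map $T(x)=f(x)\oplus w$ with $f$ a group automorphism of $(\mathbb{Z}_{12},\oplus)$ and $w\in\mathbb{Z}_{12}$. The unoriented Cayley graph distance $d$ w.r.t. $S$: $d(g,g)=0$ and for $g\ne h$, $d(g,h)$ is the least $k$ such that there are $x_0=g,\dots,x_k=h$ with $x_{i+1}\ominus x_i\in S$ for all $i$. $T$ is an isometry if $d(T(x),T(y))=d(x,y)$ for all $x,y$. -}

module Defs where

open import Data.Nat using (ℕ; _+_; _*_; _∸_; _<_)
open import Data.Nat.DivMod using (_mod_)
open import Data.Fin using (Fin; toℕ)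
open import Data.Fin.Subset using (Subset; _∈_; _⊆_)
open import Data.Vec using (tabulate)
open import Data.List using (List; []; _∷_)
open import Data.Bool.ListAction using (any)
open import Data.Bool using (Bool)
open import Data.Nat using (_≡ᵇ_)
open import Data.Product using (Σ; ∃; _×_; _,_)
open import Data.Sum using (_⊎_)
open import Data.Empty using (⊥)
open import Relation.Nullary using (¬_)
open import Relation.Binary.PropositionalEquality using (_≡_)
open import Function.Definitions using (Bijective)
open import Function.Bundles using (_⇔_)

Z12 : Set
Z12 = Fin 12

infixl 6 _⊕_ _⊖_
infixl 7 _·_

_⊕_ : Z12 → Z12 → Z12
a ⊕ b = (toℕ a + toℕ b) mod 12

_⊖_ : Z12 → Z12 → Z12
a ⊖ b = (toℕ a + (12 ∸ toℕ b)) mod 12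

_·_ : ℕ → Z12 → Z12
n · x = (n * toℕ x) mod 12

fromElems : List ℕ → Subset 12
fromElems l = tabulate (λ i → any (λ k → toℕ i ≡ᵇ k) l)

S : Subset 12
S = fromElems (3 ∷ 4 ∷ 8 ∷ 9 ∷ [])

K′ : Subset 12
K′ = fromElems (0 ∷ 3 ∷ 4 ∷ 8 ∷ 9 ∷ [])

IsAutomorphism : (Z12 → Z12) → Set
IsAutomorphism f = (∀ a b → f (a ⊕ b) ≡ f a ⊕ f b) × Bijective _≡_ _≡_ f

IsAffine : (Z12 → Z12) → Set
IsAffine T = Σ (Z12 → Z12) λ f → Σ Z12 λ w → IsAutomorphism f × (∀ x → T x ≡ f x ⊕ w)

data Walk : Z12 → Z12 → ℕ → Set where
  here : ∀ {g} → Walk g g 0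
  step : ∀ {g x h k} → (x ⊖ g) ∈ S → Walk x h k → Walk g h (Data.Nat.suc k)

Dist : Z12 → Z12 → ℕ → Set
Dist g h k = Walk g h k × (∀ j → j < k → ¬ Walk g h j)

IsIsometry : (Z12 → Z12) → Set
IsIsometry T = ∀ x y k → Dist x y k ⇔ Dist (T x) (T y) k

IsPartition : Subset 12 → Subset 12 → Set
IsPartition K D = (∀ x → x ∈ K → x ∈ D → ⊥) × (∀ x → x ∈ K ⊎ x ∈ D)

ImageEq : (Z12 → Z12) → Subset 12 → Subset 12 → Set
ImageEq T K D = ∀ y → (y ∈ D ⇔ ∃ λ x → x ∈ K × T x ≡ y)

Good : Subset 12 → Subset 12 → (Z12 → Z12) → Set
Good K D T = IsAffine T × (∀ x → T (T x) ≡ x) × ImageEq T K D × IsIsometry T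

UniqueGood : Subset 12 → Subset 12 → (Z12 → Z12) → Set
UniqueGood K D T = Good K D T × (∀ T′ → Good K D T′ → ∀ x → T′ x ≡ T x)

HasUniqueGood : Subset 12 → Subset 12 → Set
HasUniqueGood K D = Σ (Z12 → Z12) λ T → UniqueGood K D T

K₁ D₁ K₂ D₂ K₃ D₃ K₄ D₄ : Subset 12
K₁ = fromElems (0 ∷ 3 ∷ 4 ∷ 7 ∷ 8 ∷ 9 ∷ [])
D₁ = fromElems (1 ∷ 2 ∷ 5 ∷ 6 ∷ 10 ∷ 11 ∷ [])
K₂ = fromElems (0 ∷ 1 ∷ 3 ∷ 4 ∷ 8 ∷ 9 ∷ [])
D₂ = fromElems (2 ∷ 5 ∷ 6 ∷ 7 ∷ 10 ∷ 11 ∷ [])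
K₃ = fromElems (0 ∷ 3 ∷ 4 ∷ 5 ∷ 8 ∷ 9 ∷ [])
D₃ = fromElems (1 ∷ 2 ∷ 6 ∷ 7 ∷ 10 ∷ 11 ∷ [])
K₄ = fromElems (0 ∷ 3 ∷ 4 ∷ 8 ∷ 9 ∷ 11 ∷ [])
D₄ = fromElems (1 ∷ 2 ∷ 5 ∷ 6 ∷ 7 ∷ 10 ∷ [])

Tₐ Tᵦ : Z12 → Z12
Tₐ x = 5 · x ⊕ (2 mod 12)
Tᵦ x = 5 · x ⊕ (10 mod 12)

-- An endomorphism of ℤ₁₂ is determined by the image c of 1, so an affine T is x ↦ c x ⊕ w.
-- If T is an involution carrying K onto D, it has no fixed point and moves every point of K′
-- out of K′; among the 144 affine maps only 5x ⊕ 2 and 5x ⊕ 10 do this. Each pairs the five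
-- points of K′ with five points outside K′, leaving a single orbit {a, T a}, and K must be K′
-- together with one point of that orbit. Conversely 5x ⊕ w multiplies differences by 5, which
-- permutes S, so it maps walks to walks and is an isometry.
module Submission where

open import Defs
open import Data.Nat using (ℕ; zero; suc)
open import Data.Nat.GeneralisedArithmetic using (fold)
open import Data.Fin using (#_; toℕ)
open import Data.Fin.Properties using (all?; any?; _≟_)
open import Data.Fin.Subset using (Subset; _∈_; _∉_; _⊆_; _∪_; ⁅_⁆)
open import Data.Fin.Subset.Properties using (_∈?_; _⊆?_; ⊆-antisym; x∈p∪q⁻; x∈⁅y⁆⇒x≡y)
open import Data.Product using (_×_; _,_; ∃; proj₁; proj₂)
open import Data.Sum using (_⊎_; inj₁; inj₂; [_,_]; swap)
import Data.Sum as Sum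
open import Data.Empty using (⊥-elim)
open import Function.Base using (_∘_; id)
open import Function.Definitions using (Bijective)
open import Function.Bundles using (Equivalence; mk⇔)
open import Function.Consequences using (inverseᵇ⇒bijective)
open import Function.Consequences.Propositional using (strictlyInverseˡ⇒inverseˡ; strictlyInverseʳ⇒inverseʳ)
open import Relation.Nullary using (Dec; ¬_; no)
open import Relation.Nullary.Decidable using (from-yes; _×-dec_; _→-dec_; _⊎-dec_; ¬?)
open import Relation.Binary.PropositionalEquality
  using (_≡_; _≢_; _≗_; refl; sym; trans; cong; cong₂; subst; subst₂; module ≡-Reasoning)
open ≡-Reasoning

Involutive : (Z12 → Z12) → Set
Involutive t = ∀ x → t (t x) ≡ x

FixedPointFree : (Z12 → Z12) → Set
FixedPointFree t = ∀ x → t x ≢ x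

MapsTo : (Z12 → Z12) → Subset 12 → Subset 12 → Set
MapsTo t P Q = ∀ x → x ∈ P → t x ∈ Q

MovesOutOf : (Z12 → Z12) → Subset 12 → Set
MovesOutOf t P = ∀ x → x ∈ P → t x ∉ P

PreservesAdjacency : (Z12 → Z12) → Set
PreservesAdjacency t = ∀ g x → x ⊖ g ∈ S → t x ⊖ t g ∈ S

IsEndomorphism : (Z12 → Z12) → Set
IsEndomorphism f = ∀ a b → f (a ⊕ b) ≡ f a ⊕ f b

Solution : Subset 12 → Subset 12 → (Z12 → Z12) → Set
Solution K D T = IsPartition K D × K′ ⊆ K × UniqueGood K D T

isPartition? : ∀ K D → Dec (IsPartition K D)
isPartition? K D = all? (λ x → (x ∈? K) →-dec (x ∈? D) →-dec no λ ())
            ×-dec all? (λ x → (x ∈? K) ⊎-dec (x ∈? D))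

mapsTo? : ∀ t P Q → Dec (MapsTo t P Q)
mapsTo? t P Q = all? λ x → (x ∈? P) →-dec (t x ∈? Q)

∪-⁅⁆-⊆ : ∀ {P Q : Subset 12} {a} → P ⊆ Q → a ∈ Q → P ∪ ⁅ a ⁆ ⊆ Q
∪-⁅⁆-⊆ {P} {a = a} P⊆Q a∈Q x∈P∪a with x∈p∪q⁻ P ⁅ a ⁆ x∈P∪a
... | inj₁ x∈P = P⊆Q x∈P
... | inj₂ x∈a = subst (_∈ _) (sym (x∈⁅y⁆⇒x≡y a x∈a)) a∈Q

partition-unique : ∀ {K D K₀ D₀} → IsPartition K D → IsPartition K₀ D₀ →
                   K₀ ⊆ K → D₀ ⊆ D → (K , D) ≡ (K₀ , D₀)
partition-unique {K} {D} {K₀} {D₀} (disj , cover) (_ , cover₀) K₀⊆K D₀⊆D =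
  cong₂ _,_ (⊆-antisym K⊆K₀ K₀⊆K) (⊆-antisym D⊆D₀ D₀⊆D)
  where
  K⊆K₀ : K ⊆ K₀
  K⊆K₀ {x} x∈K = [ id , (λ x∈D₀ → ⊥-elim (disj x x∈K (D₀⊆D x∈D₀))) ] (cover₀ x)
  D⊆D₀ : D ⊆ D₀
  D⊆D₀ {x} x∈D = [ (λ x∈K₀ → ⊥-elim (disj x (K₀⊆K x∈K₀) x∈D)) , id ] (cover₀ x)

involutive⇒bijective : ∀ {t} → Involutive t → Bijective _≡_ _≡_ t
involutive⇒bijective {t} inv = inverseᵇ⇒bijective _≡_ refl sym trans
  (strictlyInverseˡ⇒inverseˡ t inv , strictlyInverseʳ⇒inverseʳ t inv)

swapping-involution⇒imageEq : ∀ {t K D} → Involutive t → MapsTo t K D → MapsTo t D K → ImageEq t K D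
swapping-involution⇒imageEq inv K→D D→K y =
  mk⇔ (λ y∈D → _ , D→K y y∈D , inv y) (λ { (x , x∈K , refl) → K→D x x∈K })

module _ {t} (inv : Involutive t) (adjacent : PreservesAdjacency t) where

  map-walk : ∀ {g h k} → Walk g h k → Walk (t g) (t h) k
  map-walk here = here
  map-walk (step {g} {x} x-g∈S w) = step (adjacent g x x-g∈S) (map-walk w)

  unmap-walk : ∀ {g h k} → Walk (t g) (t h) k → Walk g h k
  unmap-walk {g} {h} {k} w = subst₂ (λ a b → Walk a b k) (inv g) (inv h) (map-walk w)

  adjacency-preserving-involution⇒isometry : IsIsometry t
  adjacency-preserving-involution⇒isometry x y k = mk⇔
    (λ (w , minimal) → map-walk w , λ j j<k w′ → minimal j j<k (unmap-walk w′))
    (λ (w , minimal) → unmap-walk w , λ j j<k w′ → minimal j j<k (map-walk w′))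

⊕-idempotent⇒0 : ∀ (a : Z12) → a ≡ a ⊕ a → a ≡ # 0
⊕-idempotent⇒0 = from-yes (all? λ (a : Z12) → (a ≟ a ⊕ a) →-dec (a ≟ # 0))

·-isEndomorphism : ∀ (c : Z12) → IsEndomorphism (toℕ c ·_)
·-isEndomorphism = from-yes (all? λ (c : Z12) → all? λ (a : Z12) → all? λ (b : Z12) →
  toℕ c · (a ⊕ b) ≟ toℕ c · a ⊕ toℕ c · b)

·-identityʳ : ∀ (c : Z12) → toℕ c · # 1 ≡ c
·-identityʳ = from-yes (all? λ (c : Z12) → toℕ c · # 1 ≟ c)

_×1 : ℕ → Z12
n ×1 = fold (# 0) (# 1 ⊕_) n

toℕ-×1 : ∀ (x : Z12) → toℕ x ×1 ≡ x
toℕ-×1 = from-yes (all? λ (x : Z12) → toℕ x ×1 ≟ x)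

endomorphism-0 : ∀ f → IsEndomorphism f → f (# 0) ≡ # 0
endomorphism-0 f f-endo = ⊕-idempotent⇒0 (f (# 0)) (f-endo (# 0) (# 0))

endomorphism-determined-by-1 : ∀ f g → IsEndomorphism f → IsEndomorphism g →
                               f (# 1) ≡ g (# 1) → ∀ x → f x ≡ g x
endomorphism-determined-by-1 f g f-endo g-endo f1≡g1 x =
  subst (λ y → f y ≡ g y) (toℕ-×1 x) (agree (toℕ x))
  where
  agree : ∀ n → f (n ×1) ≡ g (n ×1)
  agree zero    = trans (endomorphism-0 f f-endo) (sym (endomorphism-0 g g-endo))
  agree (suc n) = begin
    f (# 1 ⊕ n ×1)       ≡⟨ f-endo (# 1) (n ×1) ⟩
    f (# 1) ⊕ f (n ×1)   ≡⟨ cong₂ _⊕_ f1≡g1 (agree n) ⟩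
    g (# 1) ⊕ g (n ×1)   ≡⟨ g-endo (# 1) (n ×1) ⟨
    g (# 1 ⊕ n ×1)       ∎

endomorphism≗· : ∀ f → IsEndomorphism f → ∀ x → f x ≡ toℕ (f (# 1)) · x
endomorphism≗· f f-endo = endomorphism-determined-by-1 f (toℕ c ·_) f-endo (·-isEndomorphism c) (sym (·-identityʳ c))
  where c = f (# 1)

affine : Z12 → Z12 → Z12 → Z12
affine c w x = toℕ c · x ⊕ w

affine-classification : ∀ (c w : Z12) → Involutive (affine c w) → FixedPointFree (affine c w) →
                        MovesOutOf (affine c w) K′ → affine c w ≗ Tₐ ⊎ affine c w ≗ Tᵦ
affine-classification = from-yes (all? λ (c : Z12) → all? λ (w : Z12) →
  all? (λ (x : Z12) → affine c w (affine c w x) ≟ x) →-dec all? (λ (x : Z12) → ¬? (affine c w x ≟ x)) →-dec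
  all? (λ (x : Z12) → (x ∈? K′) →-dec ¬? (affine c w x ∈? K′)) →-dec
  (all? (λ (x : Z12) → affine c w x ≟ Tₐ x) ⊎-dec all? (λ (x : Z12) → affine c w x ≟ Tᵦ x)))

module Swapping {K D T} (part : IsPartition K D) (inv : Involutive T) (img : ImageEq T K D) where
  private
    disjoint = proj₁ part

  ∈K⇒T∈D : MapsTo T K D
  ∈K⇒T∈D x x∈K = Equivalence.from (img (T x)) (x , x∈K , refl)

  ∈D⇒T∈K : MapsTo T D K
  ∈D⇒T∈K x x∈D with Equivalence.to (img x) x∈D
  ... | y , y∈K , refl = subst (_∈ K) (sym (inv y)) y∈K

  ∈K⇒T∉K : MovesOutOf T K
  ∈K⇒T∉K x x∈K Tx∈K = disjoint (T x) Tx∈K (∈K⇒T∈D x x∈K)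

  T-fixedPointFree : FixedPointFree T
  T-fixedPointFree x Tx≡x with proj₂ part x
  ... | inj₁ x∈K = ∈K⇒T∉K x x∈K (subst (_∈ K) (sym Tx≡x) x∈K)
  ... | inj₂ x∈D = disjoint x (subst (_∈ K) Tx≡x (∈D⇒T∈K x x∈D)) x∈D

classification : ∀ {K D T} → IsPartition K D → K′ ⊆ K → Good K D T → T ≗ Tₐ ⊎ T ≗ Tᵦ
classification {T = T} part K′⊆K ((f , w , (f-endo , _) , T≗f⊕w) , inv , img , _) =
  Sum.map (λ a≗Tₐ x → trans (T≗a x) (a≗Tₐ x)) (λ a≗Tᵦ x → trans (T≗a x) (a≗Tᵦ x))
          (affine-classification c w a-involutive a-fixedPointFree a-movesOutOfK′)
  where
  open Swapping part inv img
  c = f (# 1)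
  a = affine c w
  T≗a : T ≗ a
  T≗a x = trans (T≗f⊕w x) (cong (_⊕ w) (endomorphism≗· f f-endo x))
  a-involutive : Involutive a
  a-involutive x = begin
    a (a x)   ≡⟨ cong a (T≗a x) ⟨
    a (T x)   ≡⟨ T≗a (T x) ⟨
    T (T x)   ≡⟨ inv x ⟩
    x         ∎
  a-fixedPointFree : FixedPointFree a
  a-fixedPointFree x ax≡x = T-fixedPointFree x (trans (T≗a x) ax≡x)
  a-movesOutOfK′ : MovesOutOf a K′
  a-movesOutOfK′ x x∈K′ ax∈K′ = ∈K⇒T∉K x (K′⊆K x∈K′) (K′⊆K (subst (_∈ K′) (sym (T≗a x)) ax∈K′))

5·-involutive : Involutive (5 ·_)
5·-involutive = from-yes (all? λ (x : Z12) → 5 · (5 · x) ≟ x)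

5·⊕-isAffine : ∀ w → IsAffine (λ x → 5 · x ⊕ w)
5·⊕-isAffine w = (5 ·_) , w , (·-isEndomorphism (# 5) , involutive⇒bijective 5·-involutive) , λ _ → refl

5·⊕-preservesAdjacency : ∀ (w : Z12) → PreservesAdjacency (λ x → 5 · x ⊕ w)
5·⊕-preservesAdjacency = from-yes (all? λ (w : Z12) → all? λ (g : Z12) → all? λ (x : Z12) →
  (x ⊖ g ∈? S) →-dec ((5 · x ⊕ w) ⊖ (5 · g ⊕ w) ∈? S))

Tₐ-involutive : Involutive Tₐ
Tₐ-involutive = from-yes (all? λ (x : Z12) → Tₐ (Tₐ x) ≟ x)

Tᵦ-involutive : Involutive Tᵦ
Tᵦ-involutive = from-yes (all? λ (x : Z12) → Tᵦ (Tᵦ x) ≟ x)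

unique-solution : ∀ {K₀ D₀ t t′} → IsAffine t → Involutive t → PreservesAdjacency t →
                  IsPartition K₀ D₀ → K′ ⊆ K₀ → (∀ {T} → Good K₀ D₀ T → T ≗ t ⊎ T ≗ t′) →
                  MapsTo t K₀ D₀ → MapsTo t D₀ K₀ → ∃ (λ x → x ∈ K₀ × t′ x ∈ K₀) → Solution K₀ D₀ t
unique-solution {K₀} aff inv adjacent part K′⊆K₀ dichotomy K→D D→K (x , x∈K₀ , t′x∈K₀) =
  part , K′⊆K₀ , good , λ T good-T → [ id , ⊥-elim ∘ excluded good-T ] (dichotomy good-T)
  where
  good = aff , inv , swapping-involution⇒imageEq inv K→D D→K ,
         adjacency-preserving-involution⇒isometry inv adjacent
  excluded : ∀ {T} → Good K₀ _ T → ¬ T ≗ _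
  excluded (_ , inv-T , img-T , _) T≗t′ =
    Swapping.∈K⇒T∉K part inv-T img-T x x∈K₀ (subst (_∈ K₀) (sym (T≗t′ x)) t′x∈K₀)

Tₐ-solution : ∀ {K₀ D₀} → IsPartition K₀ D₀ → K′ ⊆ K₀ → MapsTo Tₐ K₀ D₀ → MapsTo Tₐ D₀ K₀ →
              ∃ (λ x → x ∈ K₀ × Tᵦ x ∈ K₀) → Solution K₀ D₀ Tₐ
Tₐ-solution part K′⊆K₀ = unique-solution (5·⊕-isAffine _) Tₐ-involutive (5·⊕-preservesAdjacency _)
                                         part K′⊆K₀ (classification part K′⊆K₀)

Tᵦ-solution : ∀ {K₀ D₀} → IsPartition K₀ D₀ → K′ ⊆ K₀ → MapsTo Tᵦ K₀ D₀ → MapsTo Tᵦ D₀ K₀ →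
              ∃ (λ x → x ∈ K₀ × Tₐ x ∈ K₀) → Solution K₀ D₀ Tᵦ
Tᵦ-solution part K′⊆K₀ = unique-solution (5·⊕-isAffine _) Tᵦ-involutive (5·⊕-preservesAdjacency _)
                                         part K′⊆K₀ (swap ∘ classification part K′⊆K₀)

K₁-D₁-solution : Solution K₁ D₁ Tₐ
K₁-D₁-solution = Tₐ-solution (from-yes (isPartition? K₁ D₁)) (from-yes (K′ ⊆? K₁))
  (from-yes (mapsTo? Tₐ K₁ D₁)) (from-yes (mapsTo? Tₐ D₁ K₁))
  (from-yes (any? λ x → (x ∈? K₁) ×-dec (Tᵦ x ∈? K₁)))

K₂-D₂-solution : Solution K₂ D₂ Tₐ
K₂-D₂-solution = Tₐ-solution (from-yes (isPartition? K₂ D₂)) (from-yes (K′ ⊆? K₂))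
  (from-yes (mapsTo? Tₐ K₂ D₂)) (from-yes (mapsTo? Tₐ D₂ K₂))
  (from-yes (any? λ x → (x ∈? K₂) ×-dec (Tᵦ x ∈? K₂)))

K₃-D₃-solution : Solution K₃ D₃ Tᵦ
K₃-D₃-solution = Tᵦ-solution (from-yes (isPartition? K₃ D₃)) (from-yes (K′ ⊆? K₃))
  (from-yes (mapsTo? Tᵦ K₃ D₃)) (from-yes (mapsTo? Tᵦ D₃ K₃))
  (from-yes (any? λ x → (x ∈? K₃) ×-dec (Tₐ x ∈? K₃)))

K₄-D₄-solution : Solution K₄ D₄ Tᵦ
K₄-D₄-solution = Tᵦ-solution (from-yes (isPartition? K₄ D₄)) (from-yes (K′ ⊆? K₄))
  (from-yes (mapsTo? Tᵦ K₄ D₄)) (from-yes (mapsTo? Tᵦ D₄ K₄))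
  (from-yes (any? λ x → (x ∈? K₄) ×-dec (Tₐ x ∈? K₄)))

module _ {K D T} (part : IsPartition K D) (inv : Involutive T) (img : ImageEq T K D) where
  open Swapping part inv img

  ≡-solution : ∀ {K₀ D₀ t} → T ≗ t → Solution K₀ D₀ t → K₀ ⊆ K → (K , D) ≡ (K₀ , D₀)
  ≡-solution {K₀} T≗t (part₀ , _ , (_ , inv₀ , img₀ , _) , _) K₀⊆K =
    partition-unique part part₀ K₀⊆K D₀⊆D
    where
    D₀⊆D : _ ⊆ D
    D₀⊆D {y} y∈D₀ = subst (_∈ D) (inv y)
      (∈K⇒T∈D (T y) (K₀⊆K (subst (_∈ K₀) (sym (T≗t y)) (Swapping.∈D⇒T∈K part₀ inv₀ img₀ y y∈D₀))))

  orbit-choice : ∀ {t Da Db} → K′ ⊆ K → T ≗ t → ∀ a →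
                 Solution (K′ ∪ ⁅ a ⁆) Da t → Solution (K′ ∪ ⁅ t a ⁆) Db t →
                 (K , D) ≡ (K′ ∪ ⁅ a ⁆ , Da) ⊎ (K , D) ≡ (K′ ∪ ⁅ t a ⁆ , Db)
  orbit-choice K′⊆K T≗t a sol-a sol-ta with proj₂ part a
  ... | inj₁ a∈K = inj₁ (≡-solution T≗t sol-a (∪-⁅⁆-⊆ K′⊆K a∈K))
  ... | inj₂ a∈D = inj₂ (≡-solution T≗t sol-ta (∪-⁅⁆-⊆ K′⊆K (subst (_∈ K) (T≗t a) (∈D⇒T∈K a a∈D))))

only-four-solutions : ∀ (K D : Subset 12) → IsPartition K D → K′ ⊆ K → HasUniqueGood K D →
  ((K , D) ≡ (K₁ , D₁)) ⊎ ((K , D) ≡ (K₂ , D₂)) ⊎ ((K , D) ≡ (K₃ , D₃)) ⊎ ((K , D) ≡ (K₄ , D₄))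
only-four-solutions K D part K′⊆K (T , good@(_ , inv , img , _) , _) =
  [ (λ T≗Tₐ → Sum.map₂ inj₁ (orbit-choice part inv img K′⊆K T≗Tₐ (# 7) K₁-D₁-solution K₂-D₂-solution))
  , (λ T≗Tᵦ → inj₂ (inj₂ (orbit-choice part inv img K′⊆K T≗Tᵦ (# 5) K₃-D₃-solution K₄-D₄-solution)))
  ] (classification part K′⊆K good)

theorem4p13 :
    -- every partition (K,D) with K' ⊆ K admitting a unique such T is one of the four
    (∀ (K D : Subset 12) → IsPartition K D → K′ ⊆ K → HasUniqueGood K D →
      ((K , D) ≡ (K₁ , D₁)) ⊎ ((K , D) ≡ (K₂ , D₂)) ⊎ ((K , D) ≡ (K₃ , D₃)) ⊎ ((K , D) ≡ (K₄ , D₄)))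
    -- and the four are such partitions, with the stated unique maps
    × (IsPartition K₁ D₁ × K′ ⊆ K₁ × UniqueGood K₁ D₁ Tₐ)
    × (IsPartition K₂ D₂ × K′ ⊆ K₂ × UniqueGood K₂ D₂ Tₐ)
    × (IsPartition K₃ D₃ × K′ ⊆ K₃ × UniqueGood K₃ D₃ Tᵦ)
    × (IsPartition K₄ D₄ × K′ ⊆ K₄ × UniqueGood K₄ D₄ Tᵦ)
theorem4p13 = only-four-solutions , K₁-D₁-solution , K₂-D₂-solution , K₃-D₃-solution , K₄-D₄-solution
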